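{- For every integer $n\ge 5$, the number of permutations of $[n]$ that contain no occurrence of the pattern $123$ and exactly four occurrences of the pattern $132$ equals \[ 2\binom{n-4}{1}2^{n-5}+3\binom{n-4}{2}2^{n-6}+\binom{n-4}{3}2^{n-7}+\binom{n-5}{3}2^{n-8}+\binom{n-5}{4}2^{n-9}. \]
   Context: A permutation of $[n]$ is a word $\pi_1\cdots\pi_n$. An occurrence of $123$ in $\pi$ is a triple of positions $i<j<k$ with $\pi_i<\pi_j<\pi_k$; an occurrence of $132$ is a triple of positions $i<j<k$ with $\pi_i<\pi_k<\pi_j$. -}

module Defs where

open import Data.Nat using (ℕ; zero; suc; _+_; _*_; _∸_; _^_)
open import Data.Nat.Combinatorics using (_C_)
open import Data.Fin using (Fin; toℕ; _<_; _<?_)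
open import Data.Fin.Properties using (_≟_)
open import Data.Vec using (Vec; []; _∷_; lookup)
open import Data.List using (List; []; _∷_; length; filter; concatMap; map; allFin)
open import Data.Product using (_×_; _,_)
open import Relation.Binary.PropositionalEquality using (_≡_)
open import Relation.Nullary using (Dec; ¬_)
open import Relation.Nullary.Decidable using (_×-dec_; _→-dec_; ¬?)
open import Data.List.Relation.Unary.All using (All; all?)

-- A word π₁⋯πₙ of length n with letters in [n] (encoded 0-based as Fin n).
Word : ℕ → Set
Word n = Vec (Fin n) n

allVecs : (k m : ℕ) → List (Vec (Fin k) m)
allVecs k zero = [] ∷ []
allVecs k (suc m) = concatMap (λ x → map (x ∷_) (allVecs k m)) (allFin k)

pairs : (n : ℕ) → List (Fin n × Fin n)
pairs n = concatMap (λ i → map (i ,_) (allFin n)) (allFin n)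

triples : (n : ℕ) → List (Fin n × Fin n × Fin n)
triples n = concatMap (λ i → concatMap (λ j → map (λ k → (i , j , k)) (allFin n)) (allFin n)) (allFin n)

-- A word of length n over [n] is a permutation of [n] iff it is injective.
IsPerm : {n : ℕ} → Word n → Set
IsPerm {n} w = All (λ { (i , j) → lookup w i ≡ lookup w j → i ≡ j }) (pairs n)

isPerm? : {n : ℕ} → (w : Word n) → Dec (IsPerm w)
isPerm? {n} w = all? (λ { (i , j) → (lookup w i ≟ lookup w j) →-dec (i ≟ j) }) (pairs n)

perms : (n : ℕ) → List (Word n)
perms n = filter isPerm? (allVecs n n)

Occ123 : {n : ℕ} → Word n → Fin n × Fin n × Fin n → Set
Occ123 w (i , j , k) = (i < j × j < k) × (lookup w i < lookup w j × lookup w j < lookup w k)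

occ123? : {n : ℕ} (w : Word n) (t : Fin n × Fin n × Fin n) → Dec (Occ123 w t)
occ123? w (i , j , k) = ((i <? j) ×-dec (j <? k)) ×-dec ((lookup w i <? lookup w j) ×-dec (lookup w j <? lookup w k))

Occ132 : {n : ℕ} → Word n → Fin n × Fin n × Fin n → Set
Occ132 w (i , j , k) = (i < j × j < k) × (lookup w i < lookup w k × lookup w k < lookup w j)

occ132? : {n : ℕ} (w : Word n) (t : Fin n × Fin n × Fin n) → Dec (Occ132 w t)
occ132? w (i , j , k) = ((i <? j) ×-dec (j <? k)) ×-dec ((lookup w i <? lookup w k) ×-dec (lookup w k <? lookup w j))

#123 : {n : ℕ} → Word n → ℕ
#123 {n} w = length (filter (occ123? w) (triples n))

#132 : {n : ℕ} → Word n → ℕ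
#132 {n} w = length (filter (occ132? w) (triples n))

Good : ℕ → {n : ℕ} → Word n → Set
Good r w = #123 w ≡ 0 × #132 w ≡ r

good? : (r : ℕ) {n : ℕ} (w : Word n) → Dec (Good r w)
good? r w = (#123 w Data.Nat.≟ 0) ×-dec (#132 w Data.Nat.≟ r)

count : ℕ → ℕ → ℕ
count r n = length (filter (good? r) (perms n))

formula : ℕ → ℕ
formula n = 2 * ((n ∸ 4) C 1) * 2 ^ (n ∸ 5)
          + 3 * ((n ∸ 4) C 2) * 2 ^ (n ∸ 6)
          + ((n ∸ 4) C 3) * 2 ^ (n ∸ 7)
          + ((n ∸ 5) C 3) * 2 ^ (n ∸ 8)
          + ((n ∸ 5) C 4) * 2 ^ (n ∸ 9)

module Submission where

-- A permutation of [n+1] is a letter x followed by a permutation of [n] in which the letters ≥ x are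
-- shifted up.  If k letters exceed x, the new first letter starts exactly C(k,2) new patterns, one per
-- pair of larger letters: an increasing pair gives a 123, a decreasing one a 132.  So a 123-avoider
-- with at most four 132s allows only k ≤ 3, and for k = 2 (k = 3) the two (three) largest letters must
-- already be decreasing.  Recording the number of 132s together with the relative order of the three
-- largest letters therefore gives a transfer recurrence on finitely many states in which only k ≤ 3
-- contributes.  For n = 7 + m its solution is a combination of the sequences C(m,j)·2^(m−j), j ≤ 4,
-- and comparing coefficients with the formula gives the theorem; n = 5, 6 are read off the recurrence.

open import Defs
open import Data.Bool using (Bool; true; false; T; _∧_; if_then_else_)
open import Data.Bool.Properties using (∧-zeroʳ; T-∧) renaming (_≟_ to _≟ᵇ_)
open import Data.Fin using (Fin; zero; suc; toℕ; punchIn; punchOut)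
open import Data.Fin.Properties using (_≟_; punchIn-injective; punchIn-punchOut; toℕ-injective; toℕ≤pred[n])
open import Data.List using (List; []; _∷_; _++_; map; drop; concatMap; length; filter; allFin; upTo; downFrom)
open import Data.List.Membership.Propositional using (_∈_)
open import Data.List.Membership.Propositional.Properties using (∈-map⁺; ∈-concat⁺′; ∈-allFin; ∈-upTo⁺)
open import Data.List.Relation.Unary.Any using (here; there)
import Data.List.Relation.Unary.Unique.Propositional as List
open import Data.List.Relation.Unary.AllPairs using ([]; _∷_)
open import Data.List.Properties using (map-tabulate; ≡-dec)
open import Data.List.Relation.Unary.All as ListAll using ([]; _∷_)
open import Data.Nat using (ℕ; zero; suc; pred; _+_; _*_; _∸_; _^_; _≤_; _<_; z≤n; s≤s; _≤ᵇ_; _<ᵇ_; _≡ᵇ_; _<?_)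
open import Data.Nat.GeneralisedArithmetic using (iterate)
open import Data.Nat.Combinatorics using (_C_; nCk+nC[k+1]≡[n+1]C[k+1]; k>n⇒nCk≡0)
open import Data.Nat.Solver using (module +-*-Solver)
open import Data.Nat.Properties hiding (_≟_)
open import Data.Nat.Properties using () renaming (_≟_ to _≟ℕ_)
open import Algebra.Properties.CommutativeSemigroup +-commutativeSemigroup using (interchange)
open import Algebra.Properties.CommutativeSemigroup *-commutativeSemigroup using (x∙yz≈y∙xz)
open import Data.Empty using (⊥-elim)
open import Data.Product using (_×_; _,_; ∃-syntax)
open import Data.Vec using (Vec; []; _∷_; lookup)
import Data.Vec as Vec
open import Data.Vec.Relation.Unary.All as VecAll using ([]; _∷_)
import Data.Vec.Relation.Unary.All.Properties as VecAllₚ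
open import Data.Vec.Relation.Unary.AllPairs using ([]; _∷_; allPairs?)
open import Data.Vec.Relation.Unary.Unique.Propositional using (Unique)
open import Data.Vec.Properties using (tabulate∘lookup)
open import Data.Vec.Relation.Unary.Unique.Propositional.Properties using (map⁺; tabulate⁺; lookup-injective)
open import Function using (_∘_; _⇔_; mk⇔; Equivalence)
open import Relation.Binary.PropositionalEquality
open import Relation.Nullary using (Dec; yes; no; does; ¬_; ¬?)
open import Relation.Nullary.Decidable using (does-⇔; from-yes)

-- Finite sums

∑ : {A : Set} → List A → (A → ℕ) → ℕ
∑ []       f = 0
∑ (x ∷ xs) f = f x + ∑ xs f

syntax ∑ xs (λ x → e) = ∑[ x ∈ xs ] e

𝟙 : Bool → ℕ
𝟙 true  = 1
𝟙 false = 0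

module _ {A : Set} where

  ∑-cong : {f g : A → ℕ} → (∀ x → f x ≡ g x) → ∀ xs → ∑ xs f ≡ ∑ xs g
  ∑-cong f≗g []       = refl
  ∑-cong f≗g (x ∷ xs) = cong₂ _+_ (f≗g x) (∑-cong f≗g xs)

  ∑-cong-∈ : {f g : A → ℕ} (xs : List A) → (∀ {x} → x ∈ xs → f x ≡ g x) → ∑ xs f ≡ ∑ xs g
  ∑-cong-∈ []       f≗g = refl
  ∑-cong-∈ (x ∷ xs) f≗g = cong₂ _+_ (f≗g (here refl)) (∑-cong-∈ xs (f≗g ∘ there))

  ∑-zero : (xs : List A) → ∑[ x ∈ xs ] 0 ≡ 0
  ∑-zero []       = refl
  ∑-zero (x ∷ xs) = ∑-zero xs

  ∑-++ : (f : A → ℕ) (xs ys : List A) → ∑ (xs ++ ys) f ≡ ∑ xs f + ∑ ys f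
  ∑-++ f []       ys = refl
  ∑-++ f (x ∷ xs) ys = trans (cong (f x +_) (∑-++ f xs ys)) (sym (+-assoc (f x) _ _))

  ∑-+ : (f g : A → ℕ) (xs : List A) → ∑[ x ∈ xs ] (f x + g x) ≡ ∑ xs f + ∑ xs g
  ∑-+ f g []       = refl
  ∑-+ f g (x ∷ xs) rewrite ∑-+ f g xs = interchange (f x) (g x) (∑ xs f) (∑ xs g)

  ∑-*ˡ : (c : ℕ) (f : A → ℕ) (xs : List A) → ∑[ x ∈ xs ] (c * f x) ≡ c * ∑ xs f
  ∑-*ˡ c f []       = sym (*-zeroʳ c)
  ∑-*ˡ c f (x ∷ xs) rewrite ∑-*ˡ c f xs = sym (*-distribˡ-+ c (f x) (∑ xs f))

  ∑-*ʳ : (c : ℕ) (f : A → ℕ) (xs : List A) → ∑[ x ∈ xs ] (f x * c) ≡ ∑ xs f * c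
  ∑-*ʳ c f []       = refl
  ∑-*ʳ c f (x ∷ xs) rewrite ∑-*ʳ c f xs = sym (*-distribʳ-+ c (f x) (∑ xs f))

  ∑-mono-≤ : {f g : A → ℕ} → (∀ x → f x ≤ g x) → ∀ xs → ∑ xs f ≤ ∑ xs g
  ∑-mono-≤ f≤g []       = z≤n
  ∑-mono-≤ f≤g (x ∷ xs) = +-mono-≤ (f≤g x) (∑-mono-≤ f≤g xs)

  length-filter : {P : A → Set} (P? : ∀ x → Dec (P x)) (xs : List A) →
                  length (filter P? xs) ≡ ∑[ x ∈ xs ] 𝟙 (does (P? x))
  length-filter P? []       = refl
  length-filter P? (x ∷ xs) with does (P? x)
  ... | true  = cong suc (length-filter P? xs)
  ... | false = length-filter P? xs

  ∑-filter : {P : A → Set} (P? : ∀ x → Dec (P x)) (f : A → ℕ) (xs : List A) →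
             ∑ (filter P? xs) f ≡ ∑[ x ∈ xs ] (𝟙 (does (P? x)) * f x)
  ∑-filter P? f []       = refl
  ∑-filter P? f (x ∷ xs) with does (P? x)
  ... | true  = cong₂ _+_ (sym (+-identityʳ (f x))) (∑-filter P? f xs)
  ... | false = ∑-filter P? f xs

module _ {A B : Set} where

  ∑-map : (f : B → ℕ) (g : A → B) (xs : List A) → ∑ (map g xs) f ≡ ∑ xs (f ∘ g)
  ∑-map f g []       = refl
  ∑-map f g (x ∷ xs) = cong (f (g x) +_) (∑-map f g xs)

  ∑-concatMap : (f : B → ℕ) (g : A → List B) (xs : List A) →
                ∑ (concatMap g xs) f ≡ ∑[ x ∈ xs ] ∑ (g x) f
  ∑-concatMap f g []       = refl
  ∑-concatMap f g (x ∷ xs) = trans (∑-++ f (g x) (concatMap g xs)) (cong (∑ (g x) f +_) (∑-concatMap f g xs))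

  ∑-comm : (f : A → B → ℕ) (xs : List A) (ys : List B) →
           ∑[ x ∈ xs ] ∑[ y ∈ ys ] f x y ≡ ∑[ y ∈ ys ] ∑[ x ∈ xs ] f x y
  ∑-comm f []       ys = sym (∑-zero ys)
  ∑-comm f (x ∷ xs) ys rewrite ∑-comm f xs ys = sym (∑-+ (f x) (λ y → ∑[ x ∈ xs ] f x y) ys)

∑-allFin-suc : ∀ n (f : Fin (suc n) → ℕ) → ∑ (allFin (suc n)) f ≡ f zero + ∑ (allFin n) (f ∘ suc)
∑-allFin-suc n f = cong (f zero +_) (trans (cong (λ xs → ∑ xs f) (sym (map-tabulate (λ i → i) suc))) (∑-map f suc (allFin n)))

∑-allFin-suc-zero : ∀ m (f : Fin (suc m) → ℕ) → f zero ≡ 0 → ∑ (allFin (suc m)) f ≡ ∑ (allFin m) (f ∘ suc)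
∑-allFin-suc-zero m f f0≡0 = trans (∑-allFin-suc m f) (cong (_+ ∑ (allFin m) (f ∘ suc)) f0≡0)

∑-allFin-downFrom : ∀ n (f : ℕ → ℕ) → ∑[ x ∈ allFin (suc n) ] f (n ∸ toℕ x) ≡ ∑ (downFrom (suc n)) f
∑-allFin-downFrom zero    f = refl
∑-allFin-downFrom (suc n) f = trans (∑-allFin-suc (suc n) (λ x → f (suc n ∸ toℕ x))) (cong (f (suc n) +_) (∑-allFin-downFrom n f))

𝟙-∧ : ∀ a b → 𝟙 (a ∧ b) ≡ 𝟙 a * 𝟙 b
𝟙-∧ true  b = sym (+-identityʳ (𝟙 b))
𝟙-∧ false b = refl

<ᵇ-suc : ∀ a b → (a <ᵇ suc b) ≡ (a ≤ᵇ b)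
<ᵇ-suc zero    b = refl
<ᵇ-suc (suc a) b = refl

≤ᵇ-true : ∀ {m n} → m ≤ n → (m ≤ᵇ n) ≡ true
≤ᵇ-true {zero}  _       = refl
≤ᵇ-true {suc m} (s≤s p) = trans (<ᵇ-suc m _) (≤ᵇ-true p)

≤ᵇ-false : ∀ {m n} → n < m → (m ≤ᵇ n) ≡ false
≤ᵇ-false {suc m} {zero}  _       = refl
≤ᵇ-false {suc m} {suc n} (s≤s p) = trans (<ᵇ-suc m n) (≤ᵇ-false p)

≤ᵇ-false⁻ : ∀ {m n} → (m ≤ᵇ n) ≡ false → n < m
≤ᵇ-false⁻ {m} {n} eq = ≰⇒> (λ m≤n → subst T eq (≤⇒≤ᵇ m≤n))

-- Permutations as duplicate-free vectors

unique? : ∀ {N m} (w : Vec (Fin N) m) → Dec (Unique w)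
unique? = allPairs? (λ a b → ¬? (a ≟ b))

avoids? : ∀ {N m} (x : Fin N) (w : Vec (Fin N) m) → Dec (VecAll.All (λ y → ¬ x ≡ y) w)
avoids? x = VecAll.all? (λ y → ¬? (x ≟ y))

injective⇒unique : {A : Set} {m : ℕ} {w : Vec A m} → (∀ i j → lookup w i ≡ lookup w j → i ≡ j) → Unique w
injective⇒unique {w = w} inj = subst Unique (tabulate∘lookup w) (tabulate⁺ (inj _ _))

unique-map⁻ : {A B : Set} {f : A → B} {m : ℕ} {σ : Vec A m} → Unique (Vec.map f σ) → Unique σ
unique-map⁻ {σ = []}    []       = []
unique-map⁻ {σ = _ ∷ _} (px ∷ u) = VecAll.map (λ fx≢fy → fx≢fy ∘ cong _) (VecAllₚ.map⁻ px) ∷ unique-map⁻ u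

∈-pairs : ∀ {n} (i j : Fin n) → (i , j) ∈ pairs n
∈-pairs {n} i j = ∈-concat⁺′ (∈-map⁺ (i ,_) (∈-allFin j)) (∈-map⁺ (λ i → map (i ,_) (allFin n)) (∈-allFin i))

isPerm⇔unique : ∀ {n} (w : Word n) → IsPerm w ⇔ Unique w
isPerm⇔unique w = mk⇔ (λ p → injective⇒unique (λ i j → ListAll.lookup p (∈-pairs i j)))
                      (λ u → ListAll.tabulate (λ { {i , j} _ → lookup-injective u i j }))

does-isPerm : ∀ {n} (w : Word n) → does (isPerm? w) ≡ does (unique? w)
does-isPerm w = does-⇔ (isPerm⇔unique w) (isPerm? w) (unique? w)

does-unique-punchIn : ∀ {n m} (x : Fin (suc n)) (σ : Vec (Fin n) m) →
                      does (unique? (Vec.map (punchIn x) σ)) ≡ does (unique? σ)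
does-unique-punchIn x σ =
  does-⇔ (mk⇔ unique-map⁻ (map⁺ (punchIn-injective x _ _))) (unique? (Vec.map (punchIn x) σ)) (unique? σ)

avoiding-image : ∀ {n m} {x : Fin (suc n)} (w : Vec (Fin (suc n)) m) →
                 VecAll.All (λ y → ¬ x ≡ y) w → ∃[ σ ] w ≡ Vec.map (punchIn x) σ
avoiding-image []      []           = [] , refl
avoiding-image (y ∷ w) (x≢y ∷ x∉w) with avoiding-image w x∉w
... | σ , refl = punchOut x≢y ∷ σ , cong (_∷ Vec.map _ σ) (sym (punchIn-punchOut x≢y))

∑-allVecs-suc : ∀ k m (f : Vec (Fin k) (suc m) → ℕ) →
                ∑ (allVecs k (suc m)) f ≡ ∑[ y ∈ allFin k ] ∑[ w ∈ allVecs k m ] f (y ∷ w)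
∑-allVecs-suc k m f = trans (∑-concatMap f _ (allFin k)) (∑-cong (λ y → ∑-map f (y ∷_) (allVecs k m)) (allFin k))

∑-punchIn : ∀ {n} (x : Fin (suc n)) (G : Fin (suc n) → ℕ) →
            ∑[ y ∈ allFin (suc n) ] (𝟙 (does (¬? (x ≟ y))) * G y) ≡ ∑[ z ∈ allFin n ] G (punchIn x z)
∑-punchIn {n} zero G =
  trans (∑-allFin-suc n (λ y → 𝟙 (does (¬? (zero ≟ y))) * G y)) (∑-cong (λ z → *-identityˡ (G (suc z))) (allFin n))
∑-punchIn {suc n} (suc x) G =
  trans (∑-allFin-suc (suc n) (λ y → 𝟙 (does (¬? (suc x ≟ y))) * G y))
        (trans (cong₂ _+_ (*-identityˡ (G zero)) (∑-punchIn x (G ∘ suc)))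
               (sym (∑-allFin-suc n (G ∘ punchIn (suc x)))))

∑-avoiding : ∀ {n} (x : Fin (suc n)) m (H : Vec (Fin (suc n)) m → ℕ) →
             ∑[ w ∈ allVecs (suc n) m ] (𝟙 (does (avoids? x w)) * H w) ≡ ∑[ σ ∈ allVecs n m ] H (Vec.map (punchIn x) σ)
∑-avoiding x zero    H = cong (_+ 0) (+-identityʳ (H []))
∑-avoiding {n} x (suc m) H = begin
  ∑[ w ∈ allVecs (suc n) (suc m) ] (𝟙 (does (avoids? x w)) * H w)
    ≡⟨ ∑-allVecs-suc (suc n) m _ ⟩
  ∑[ y ∈ allFin (suc n) ] ∑[ w ∈ allVecs (suc n) m ] (𝟙 (does (¬? (x ≟ y)) ∧ does (avoids? x w)) * H (y ∷ w))
    ≡⟨ ∑-cong (λ y → trans (∑-cong (λ w → split y w) (allVecs (suc n) m)) (∑-*ˡ (𝟙 (does (¬? (x ≟ y)))) (λ w → 𝟙 (does (avoids? x w)) * H (y ∷ w)) (allVecs (suc n) m))) (allFin (suc n)) ⟩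
  ∑[ y ∈ allFin (suc n) ] (𝟙 (does (¬? (x ≟ y))) * ∑[ w ∈ allVecs (suc n) m ] (𝟙 (does (avoids? x w)) * H (y ∷ w)))
    ≡⟨ ∑-cong (λ y → cong (𝟙 (does (¬? (x ≟ y))) *_) (∑-avoiding x m (H ∘ (y ∷_)))) (allFin (suc n)) ⟩
  ∑[ y ∈ allFin (suc n) ] (𝟙 (does (¬? (x ≟ y))) * ∑[ σ ∈ allVecs n m ] H (y ∷ Vec.map (punchIn x) σ))
    ≡⟨ ∑-punchIn x _ ⟩
  ∑[ z ∈ allFin n ] ∑[ σ ∈ allVecs n m ] H (punchIn x z ∷ Vec.map (punchIn x) σ)
    ≡⟨ sym (∑-allVecs-suc n m _) ⟩
  ∑[ σ ∈ allVecs n (suc m) ] H (Vec.map (punchIn x) σ) ∎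
  where
  open ≡-Reasoning
  split : ∀ y w → 𝟙 (does (¬? (x ≟ y)) ∧ does (avoids? x w)) * H (y ∷ w)
                ≡ 𝟙 (does (¬? (x ≟ y))) * (𝟙 (does (avoids? x w)) * H (y ∷ w))
  split y w = trans (cong (_* H (y ∷ w)) (𝟙-∧ (does (¬? (x ≟ y))) _)) (*-assoc (𝟙 (does (¬? (x ≟ y)))) _ (H (y ∷ w)))

-- Counting patterns in lists of values

values : ∀ {N m} → Vec (Fin N) m → List ℕ
values w = Vec.toList (Vec.map toℕ w)

#pairs : (ℕ → ℕ → Bool) → List ℕ → ℕ
#pairs S []       = 0
#pairs S (y ∷ ys) = ∑[ z ∈ ys ] 𝟙 (S y z) + #pairs S ys

#triples : (ℕ → ℕ → ℕ → Bool) → List ℕ → ℕ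
#triples R []       = 0
#triples R (x ∷ xs) = #pairs (R x) xs + #triples R xs

R123 R132 : ℕ → ℕ → ℕ → Bool
R123 x y z = (x <ᵇ y) ∧ (y <ᵇ z)
R132 x y z = (x <ᵇ z) ∧ (z <ᵇ y)

∑-lookup : ∀ {N m} (g : ℕ → ℕ) (w : Vec (Fin N) m) → ∑[ k ∈ allFin m ] g (toℕ (lookup w k)) ≡ ∑ (values w) g
∑-lookup g []      = refl
∑-lookup g (x ∷ w) = trans (∑-allFin-suc _ (λ k → g (toℕ (lookup (x ∷ w) k)))) (cong (g (toℕ x) +_) (∑-lookup g w))

pairAt : ∀ {N m} → (ℕ → ℕ → Bool) → Vec (Fin N) m → Fin m → Fin m → ℕ
pairAt S w j k = 𝟙 ((toℕ j <ᵇ toℕ k) ∧ S (toℕ (lookup w j)) (toℕ (lookup w k)))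

tripleAt : ∀ {N m} → (ℕ → ℕ → ℕ → Bool) → Vec (Fin N) m → Fin m → Fin m → Fin m → ℕ
tripleAt R w i j k = 𝟙 (((toℕ i <ᵇ toℕ j) ∧ (toℕ j <ᵇ toℕ k)) ∧ R (toℕ (lookup w i)) (toℕ (lookup w j)) (toℕ (lookup w k)))

#pairs-positions : ∀ {N m} (S : ℕ → ℕ → Bool) (w : Vec (Fin N) m) →
  ∑[ j ∈ allFin m ] ∑[ k ∈ allFin m ] pairAt S w j k ≡ #pairs S (values w)
#pairs-positions S []          = refl
#pairs-positions {m = suc m} S (y ∷ w) =
  trans (∑-allFin-suc m (λ j → ∑[ k ∈ allFin (suc m) ] pairAt S (y ∷ w) j k))
        (cong₂ _+_ (trans (∑-allFin-suc-zero m (pairAt S (y ∷ w) zero) refl) (∑-lookup (𝟙 ∘ S (toℕ y)) w))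
                   (trans (∑-cong (λ j → ∑-allFin-suc-zero m (pairAt S (y ∷ w) (suc j)) refl) (allFin m))
                          (#pairs-positions S w)))

#triples-positions : ∀ {N m} (R : ℕ → ℕ → ℕ → Bool) (w : Vec (Fin N) m) →
  ∑[ i ∈ allFin m ] ∑[ j ∈ allFin m ] ∑[ k ∈ allFin m ] tripleAt R w i j k ≡ #triples R (values w)
#triples-positions R []          = refl
#triples-positions {m = suc m} R (x ∷ w) =
  trans (∑-allFin-suc m (λ i → ∑[ j ∈ allFin (suc m) ] ∑[ k ∈ allFin (suc m) ] tripleAt R (x ∷ w) i j k))
        (cong₂ _+_ first-position later-positions)
  where
  at = tripleAt R (x ∷ w)
  first-position : ∑[ j ∈ allFin (suc m) ] ∑[ k ∈ allFin (suc m) ] at zero j k ≡ #pairs (R (toℕ x)) (values w)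
  first-position =
    trans (∑-allFin-suc-zero m (λ j → ∑[ k ∈ allFin (suc m) ] at zero j k) (∑-zero (allFin (suc m))))
          (trans (∑-cong (λ j → ∑-allFin-suc-zero m (at zero (suc j)) refl) (allFin m))
                 (#pairs-positions (R (toℕ x)) w))
  later-positions : ∑[ i ∈ allFin m ] ∑[ j ∈ allFin (suc m) ] ∑[ k ∈ allFin (suc m) ] at (suc i) j k ≡ #triples R (values w)
  later-positions =
    trans (∑-cong (λ i → ∑-allFin-suc-zero m (λ j → ∑[ k ∈ allFin (suc m) ] at (suc i) j k) (∑-zero (allFin (suc m)))) (allFin m))
          (trans (∑-cong (λ i → ∑-cong (λ j → ∑-allFin-suc-zero m (at (suc i) (suc j))
                                                 (cong (λ b → 𝟙 (b ∧ R (toℕ (lookup w i)) (toℕ (lookup w j)) (toℕ x))) (∧-zeroʳ (toℕ i <ᵇ toℕ j)))) (allFin m)) (allFin m))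
                 (#triples-positions R w))

∑-triples : ∀ n (f : Fin n × Fin n × Fin n → ℕ) →
            ∑ (triples n) f ≡ ∑[ i ∈ allFin n ] ∑[ j ∈ allFin n ] ∑[ k ∈ allFin n ] f (i , j , k)
∑-triples n f = trans (∑-concatMap f _ (allFin n)) (∑-cong (λ i →
                trans (∑-concatMap f _ (allFin n)) (∑-cong (λ j → ∑-map f _ (allFin n)) (allFin n))) (allFin n))

#123≡#triples : ∀ {n} (w : Word n) → #123 w ≡ #triples R123 (values w)
#123≡#triples {n} w = trans (length-filter (occ123? w) (triples n)) (trans (∑-triples n _) (#triples-positions R123 w))

#132≡#triples : ∀ {n} (w : Word n) → #132 w ≡ #triples R132 (values w)
#132≡#triples {n} w = trans (length-filter (occ132? w) (triples n)) (trans (∑-triples n _) (#triples-positions R132 w))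

#≥ : ℕ → List ℕ → ℕ
#≥ t L = ∑[ y ∈ L ] 𝟙 (t ≤ᵇ y)

asc desc : ℕ → List ℕ → ℕ
asc  t = #pairs (λ y z → (t ≤ᵇ y) ∧ (y <ᵇ z))
desc t = #pairs (λ y z → (t ≤ᵇ z) ∧ (z <ᵇ y))

C₂ : ℕ → ℕ
C₂ zero    = 0
C₂ (suc n) = n + C₂ n

<ᵇ-trichotomy : ∀ a b → a ≢ b → 𝟙 (a <ᵇ b) + 𝟙 (b <ᵇ a) ≡ 1
<ᵇ-trichotomy zero    zero    a≢b = ⊥-elim (a≢b refl)
<ᵇ-trichotomy zero    (suc b) a≢b = refl
<ᵇ-trichotomy (suc a) zero    a≢b = refl
<ᵇ-trichotomy (suc a) (suc b) a≢b = <ᵇ-trichotomy a b (a≢b ∘ cong suc)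

ascent-or-descent : ∀ t a b → a ≢ b →
                    𝟙 ((t ≤ᵇ a) ∧ (a <ᵇ b)) + 𝟙 ((t ≤ᵇ b) ∧ (b <ᵇ a)) ≡ 𝟙 (t ≤ᵇ a) * 𝟙 (t ≤ᵇ b)
ascent-or-descent zero    a       b       a≢b = <ᵇ-trichotomy a b a≢b
ascent-or-descent (suc t) zero    b       a≢b = cong 𝟙 (∧-zeroʳ (t <ᵇ b))
ascent-or-descent (suc t) (suc a) zero    a≢b =
  trans (+-identityʳ _) (trans (cong 𝟙 (∧-zeroʳ (t <ᵇ suc a))) (sym (*-zeroʳ (𝟙 (t <ᵇ suc a)))))
ascent-or-descent (suc t) (suc a) (suc b) a≢b
  rewrite <ᵇ-suc t a | <ᵇ-suc t b = ascent-or-descent t a b (a≢b ∘ cong suc)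

C₂-step : ∀ b g → 𝟙 b * g + C₂ g ≡ C₂ (𝟙 b + g)
C₂-step true  g = cong (_+ C₂ g) (+-identityʳ g)
C₂-step false g = refl

asc+desc≡C₂ : ∀ t L → List.Unique L → asc t L + desc t L ≡ C₂ (#≥ t L)
asc+desc≡C₂ t []       []          = refl
asc+desc≡C₂ t (y ∷ ys) (y∉ys ∷ u) = begin
  (∑[ z ∈ ys ] ascent z + asc t ys) + (∑[ z ∈ ys ] descent z + desc t ys)
    ≡⟨ interchange (∑ ys ascent) (asc t ys) (∑ ys descent) (desc t ys) ⟩
  (∑[ z ∈ ys ] ascent z + ∑[ z ∈ ys ] descent z) + (asc t ys + desc t ys)
    ≡⟨ cong₂ _+_ head-pairs (asc+desc≡C₂ t ys u) ⟩
  𝟙 (t ≤ᵇ y) * #≥ t ys + C₂ (#≥ t ys)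
    ≡⟨ C₂-step (t ≤ᵇ y) (#≥ t ys) ⟩
  C₂ (#≥ t (y ∷ ys)) ∎
  where
  open ≡-Reasoning
  ascent descent : ℕ → ℕ
  ascent  z = 𝟙 ((t ≤ᵇ y) ∧ (y <ᵇ z))
  descent z = 𝟙 ((t ≤ᵇ z) ∧ (z <ᵇ y))
  head-pairs : ∑ ys ascent + ∑ ys descent ≡ 𝟙 (t ≤ᵇ y) * #≥ t ys
  head-pairs = begin
    ∑ ys ascent + ∑ ys descent                 ≡⟨ ∑-+ ascent descent ys ⟨
    ∑[ z ∈ ys ] (ascent z + descent z)          ≡⟨ ∑-cong-∈ ys (λ z∈ys → ascent-or-descent t y _ (ListAll.lookup y∉ys z∈ys)) ⟩
    ∑[ z ∈ ys ] (𝟙 (t ≤ᵇ y) * 𝟙 (t ≤ᵇ z))      ≡⟨ ∑-*ˡ (𝟙 (t ≤ᵇ y)) (λ z → 𝟙 (t ≤ᵇ z)) ys ⟩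
    𝟙 (t ≤ᵇ y) * #≥ t ys                        ∎

𝟙-∧-mono : ∀ {a b} c → (T a → T b) → 𝟙 (a ∧ c) ≤ 𝟙 (b ∧ c)
𝟙-∧-mono {false}         c _   = z≤n
𝟙-∧-mono {true}  {true}  c _   = ≤-refl
𝟙-∧-mono {true}  {false} c a⇒b = ⊥-elim (a⇒b _)

#pairs-mono : ∀ {S S'} → (∀ y z → 𝟙 (S y z) ≤ 𝟙 (S' y z)) → ∀ L → #pairs S L ≤ #pairs S' L
#pairs-mono S≤S' []      = z≤n
#pairs-mono S≤S' (y ∷ L) = +-mono-≤ (∑-mono-≤ (S≤S' y) L) (#pairs-mono S≤S' L)

asc-suc-≤ : ∀ t L → asc (suc t) L ≤ asc t L
asc-suc-≤ t = #pairs-mono (λ y z → 𝟙-∧-mono (y <ᵇ z) (≤⇒≤ᵇ ∘ <⇒≤ ∘ <ᵇ⇒< t y))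

C₂-pred-gap : ∀ x → C₂ (x ∸ (x ∸ 1)) ≡ 0
C₂-pred-gap zero    = refl
C₂-pred-gap (suc x) = cong C₂ (m+n∸n≡m 1 x)

-- Prepending a letter

shift : ℕ → ℕ → ℕ
shift zero    v       = suc v
shift (suc x) zero    = zero
shift (suc x) (suc v) = suc (shift x v)

unshift : ℕ → ℕ → ℕ
unshift zero    t       = pred t
unshift (suc x) zero    = zero
unshift (suc x) (suc t) = suc (unshift x t)

toℕ-punchIn : ∀ {n} (i : Fin (suc n)) (j : Fin n) → toℕ (punchIn i j) ≡ shift (toℕ i) (toℕ j)
toℕ-punchIn zero    j       = refl
toℕ-punchIn (suc i) zero    = refl
toℕ-punchIn (suc i) (suc j) = cong suc (toℕ-punchIn i j)

values-punchIn : ∀ {n m} (x : Fin (suc n)) (σ : Vec (Fin n) m) →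
                 values (Vec.map (punchIn x) σ) ≡ map (shift (toℕ x)) (values σ)
values-punchIn x []      = refl
values-punchIn x (y ∷ σ) = cong₂ _∷_ (toℕ-punchIn x y) (values-punchIn x σ)

≤ᵇ-shift : ∀ x t v → (t ≤ᵇ shift x v) ≡ (unshift x t ≤ᵇ v)
≤ᵇ-shift zero    zero    v       = refl
≤ᵇ-shift zero    (suc t) v       = <ᵇ-suc t v
≤ᵇ-shift (suc x) zero    v       = refl
≤ᵇ-shift (suc x) (suc t) zero    = refl
≤ᵇ-shift (suc x) (suc t) (suc v) = trans (<ᵇ-suc t (shift x v)) (trans (≤ᵇ-shift x t v) (sym (<ᵇ-suc (unshift x t) v)))

<ᵇ-shift : ∀ x a b → (shift x a <ᵇ shift x b) ≡ (a <ᵇ b)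
<ᵇ-shift zero    a       b       = refl
<ᵇ-shift (suc x) zero    zero    = refl
<ᵇ-shift (suc x) zero    (suc b) = refl
<ᵇ-shift (suc x) (suc a) zero    = refl
<ᵇ-shift (suc x) (suc a) (suc b) = <ᵇ-shift x a b

<ᵇ-shift-self : ∀ x v → (x <ᵇ shift x v) ≡ (x ≤ᵇ v)
<ᵇ-shift-self zero    v       = refl
<ᵇ-shift-self (suc x) zero    = refl
<ᵇ-shift-self (suc x) (suc v) = trans (<ᵇ-shift-self x v) (sym (<ᵇ-suc x v))

unshift-≤ : ∀ {x t} → t ≤ x → unshift x t ≡ t
unshift-≤ {zero}  z≤n     = refl
unshift-≤ {suc x} z≤n     = refl
unshift-≤ {suc x} (s≤s p) = cong suc (unshift-≤ p)

unshift-> : ∀ {x t} → x < t → unshift x t ≡ pred t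
unshift-> {zero}  (s≤s p)       = refl
unshift-> {suc x} (s≤s (s≤s p)) = cong suc (unshift-> (s≤s p))

#pairs-map : ∀ {S S'} (f : ℕ → ℕ) → (∀ y z → S (f y) (f z) ≡ S' y z) → ∀ L → #pairs S (map f L) ≡ #pairs S' L
#pairs-map f eq []      = refl
#pairs-map f eq (y ∷ L) =
  cong₂ _+_ (trans (∑-map _ f L) (∑-cong (λ z → cong 𝟙 (eq y z)) L)) (#pairs-map f eq L)

#triples-map : ∀ {R R'} (f : ℕ → ℕ) → (∀ x y z → R (f x) (f y) (f z) ≡ R' x y z) → ∀ L →
               #triples R (map f L) ≡ #triples R' L
#triples-map f eq []      = refl
#triples-map f eq (x ∷ L) = cong₂ _+_ (#pairs-map f (eq x) L) (#triples-map f eq L)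

#≥-prepend : ∀ x t L → #≥ t (x ∷ map (shift x) L) ≡ 𝟙 (t ≤ᵇ x) + #≥ (unshift x t) L
#≥-prepend x t L = cong (𝟙 (t ≤ᵇ x) +_) (trans (∑-map _ (shift x) L) (∑-cong (λ v → cong 𝟙 (≤ᵇ-shift x t v)) L))

asc-prepend : ∀ x t L → asc t (x ∷ map (shift x) L) ≡ 𝟙 (t ≤ᵇ x) * #≥ x L + asc (unshift x t) L
asc-prepend x t L = cong₂ _+_ above-x
  (#pairs-map (shift x) (λ y z → cong₂ _∧_ (≤ᵇ-shift x t y) (<ᵇ-shift x y z)) L)
  where
  above-x : ∑[ z ∈ map (shift x) L ] 𝟙 ((t ≤ᵇ x) ∧ (x <ᵇ z)) ≡ 𝟙 (t ≤ᵇ x) * #≥ x L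
  above-x = trans (∑-map _ (shift x) L)
            (trans (∑-cong (λ z → trans (𝟙-∧ (t ≤ᵇ x) _) (cong (λ b → 𝟙 (t ≤ᵇ x) * 𝟙 b) (<ᵇ-shift-self x z))) L)
                   (∑-*ˡ (𝟙 (t ≤ᵇ x)) (λ z → 𝟙 (x ≤ᵇ z)) L))

#123-prepend : ∀ x L → #triples R123 (x ∷ map (shift x) L) ≡ asc x L + #triples R123 L
#123-prepend x L = cong₂ _+_
  (#pairs-map (shift x) (λ y z → cong₂ _∧_ (<ᵇ-shift-self x y) (<ᵇ-shift x y z)) L)
  (#triples-map (shift x) (λ a b c → cong₂ _∧_ (<ᵇ-shift x a b) (<ᵇ-shift x b c)) L)

#132-prepend : ∀ x L → #triples R132 (x ∷ map (shift x) L) ≡ desc x L + #triples R132 L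
#132-prepend x L = cong₂ _+_
  (#pairs-map (shift x) (λ y z → cong₂ _∧_ (<ᵇ-shift-self x z) (<ᵇ-shift x z y)) L)
  (#triples-map (shift x) (λ a b c → cong₂ _∧_ (<ᵇ-shift x a c) (<ᵇ-shift x c b)) L)

∸-unshift : ∀ {n x} t → x ≤ n → 𝟙 (t ≤ᵇ x) + (n ∸ unshift x t) ≡ suc n ∸ t
∸-unshift {n} {zero}  zero    _       = refl
∸-unshift {n} {suc x} zero    _       = refl
∸-unshift {n} {zero}  (suc t) _       = refl
∸-unshift {suc n} {suc x} (suc t) (s≤s x≤n) rewrite <ᵇ-suc t x = ∸-unshift t x≤n

record PermutationStats (n : ℕ) (L : List ℕ) : Set where
  field
    distinct : List.Unique L
    #≥-≡     : ∀ t → #≥ t L ≡ n ∸ t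

  asc+desc : ∀ t → asc t L + desc t L ≡ C₂ (n ∸ t)
  asc+desc t = trans (asc+desc≡C₂ t L distinct) (cong C₂ (#≥-≡ t))

unique-values : ∀ {N m} {w : Vec (Fin N) m} → Unique w → List.Unique (values w)
unique-values {w = []}    []       = []
unique-values {w = _ ∷ _} (px ∷ u) =
  VecAllₚ.toList⁺ (VecAllₚ.map⁺ (VecAll.map (λ x≢y → x≢y ∘ toℕ-injective) px)) ∷ unique-values u

#≥-perm : ∀ {n} (σ : Vec (Fin n) n) → Unique σ → ∀ t → #≥ t (values σ) ≡ n ∸ t
#≥-perm []               []         t = sym (0∸n≡0 t)
#≥-perm {suc n} (x ∷ w) (x∉w ∷ u) t with avoiding-image w x∉w
... | τ , refl = begin
  #≥ t (toℕ x ∷ values (Vec.map (punchIn x) τ))        ≡⟨ cong (#≥ t ∘ (toℕ x ∷_)) (values-punchIn x τ) ⟩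
  #≥ t (toℕ x ∷ map (shift (toℕ x)) (values τ))        ≡⟨ #≥-prepend (toℕ x) t (values τ) ⟩
  𝟙 (t ≤ᵇ toℕ x) + #≥ (unshift (toℕ x) t) (values τ)   ≡⟨ cong (𝟙 (t ≤ᵇ toℕ x) +_) (#≥-perm τ (unique-map⁻ u) (unshift (toℕ x) t)) ⟩
  𝟙 (t ≤ᵇ toℕ x) + (n ∸ unshift (toℕ x) t)             ≡⟨ ∸-unshift t (toℕ≤pred[n] x) ⟩
  suc n ∸ t                                             ∎
  where open ≡-Reasoning

permutationStats : ∀ {n} (σ : Vec (Fin n) n) → Unique σ → PermutationStats n (values σ)
permutationStats σ u = record { distinct = unique-values u ; #≥-≡ = #≥-perm σ u }

-- The automaton

-- The relative order of the three largest letters: desc3 if they occur in decreasing order, desc2 if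
-- only the two largest do, asc2 if the two largest occur in increasing order.
data Shape : Set where
  desc3 desc2 asc2 : Shape

-- live b q: no 123, b ≤ 4 occurrences of 132, and shape q.
data State : Set where
  dead : State
  live : ℕ → Shape → State

shapeOf : (u₂ u₃ : ℕ) → Shape
shapeOf zero    zero    = desc3
shapeOf zero    (suc _) = desc2
shapeOf (suc _) _       = asc2

alive : ℕ → Shape → State
alive b q = if b ≤ᵇ 4 then live b q else dead

classify : (a b u₂ u₃ : ℕ) → State
classify zero    b u₂ u₃ = alive b (shapeOf u₂ u₃)
classify (suc _) _ _  _  = dead

-- asc (n ∸ 2) and asc (n ∸ 3) count the ascents among the two and three largest letters.
state : ℕ → List ℕ → State
state n L = classify (#triples R123 L) (#triples R132 L) (asc (n ∸ 2) L) (asc (n ∸ 3) L)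

afterMax : Shape → Shape
afterMax desc3 = desc3
afterMax desc2 = desc3
afterMax asc2  = desc2

-- δ s k is the state after prepending a letter that is smaller than exactly k of the old letters.
δ : State → ℕ → State
δ dead           _                         = dead
δ (live b q)     zero                      = live b (afterMax q)
δ (live b q)     1                         = live b asc2
δ (live b asc2)  2                         = dead
δ (live b _)     2                         = alive (1 + b) desc2
δ (live b desc3) 3                         = alive (3 + b) desc3
δ (live b _)     3                         = dead
δ (live b q)     (suc (suc (suc (suc _)))) = dead

alive-dead : ∀ j b q → (b ≤ᵇ 4) ≡ false → alive (j + b) q ≡ dead
alive-dead j b q b≰4 = cong (if_then live (j + b) q else dead) (≤ᵇ-false (≤-trans (≤ᵇ-false⁻ b≰4) (m≤n+m b j)))

afterMax-shapeOf : ∀ u₂ u₃ → shapeOf 0 u₂ ≡ afterMax (shapeOf u₂ u₃)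
afterMax-shapeOf zero    zero    = refl
afterMax-shapeOf zero    (suc _) = refl
afterMax-shapeOf (suc _) _       = refl

classify-δ₀ : ∀ a b u₂ u₃ → classify a b 0 u₂ ≡ δ (classify a b u₂ u₃) 0
classify-δ₀ (suc a) b u₂ u₃ = refl
classify-δ₀ zero    b u₂ u₃ with b ≤ᵇ 4
... | true  = cong (live b) (afterMax-shapeOf u₂ u₃)
... | false = refl

classify-δ₁ : ∀ a b p q u₂ u₃ → classify a b (suc p) (suc q) ≡ δ (classify a b u₂ u₃) 1
classify-δ₁ (suc a) b p q u₂ u₃ = refl
classify-δ₁ zero    b p q u₂ u₃ with b ≤ᵇ 4
... | true  = refl
... | false = refl

classify-δ₂ : ∀ a b v q u₂ u₃ → u₂ + v ≡ 1 → classify (u₂ + a) (v + b) u₂ (suc q) ≡ δ (classify a b u₂ u₃) 2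
classify-δ₂ (suc a) b .1 q zero u₃ refl = refl
classify-δ₂ zero    b .1 q zero u₃ refl with b ≤ᵇ 4 in b≤4
... | false = alive-dead 1 b desc2 b≤4
... | true  with u₃
...   | zero  = refl
...   | suc _ = refl
classify-δ₂ (suc a) b .0 q (suc zero) u₃ refl = refl
classify-δ₂ zero    b .0 q (suc zero) u₃ refl with b ≤ᵇ 4
... | true  = refl
... | false = refl
classify-δ₂ a b v q (suc (suc u₂)) u₃ ()

classify-δ₃ : ∀ a b v u₂ u₃ → u₃ + v ≡ 3 → u₂ ≤ u₃ → classify (u₃ + a) (v + b) u₂ u₃ ≡ δ (classify a b u₂ u₃) 3
classify-δ₃ (suc a) b .3 zero zero refl z≤n = refl
classify-δ₃ zero    b .3 zero zero refl z≤n with b ≤ᵇ 4 in b≤4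
... | true  = refl
... | false = alive-dead 3 b desc3 b≤4
classify-δ₃ (suc a) b v u₂ (suc u₃) _ _ = refl
classify-δ₃ zero    b v u₂ (suc u₃) _ _ with b ≤ᵇ 4
... | false = refl
... | true  with u₂
...   | zero  = refl
...   | suc _ = refl

5≤C₂[4+j] : ∀ j → 5 ≤ C₂ (4 + j)
5≤C₂[4+j] j = +-mono-≤ (m≤m+n 3 j) (≤-trans (m≤m+n 2 j) (m≤m+n (2 + j) (C₂ (2 + j))))

δ-≥4 : ∀ s j → δ s (4 + j) ≡ dead
δ-≥4 dead           j = refl
δ-≥4 (live b desc3) j = refl
δ-≥4 (live b desc2) j = refl
δ-≥4 (live b asc2)  j = refl

classify-δ≥4 : ∀ j U V a b p q s → U + V ≡ C₂ (4 + j) → classify (U + a) (V + b) p q ≡ δ s (4 + j)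
classify-δ≥4 j (suc U) V a       b p q s _   = sym (δ-≥4 s j)
classify-δ≥4 j zero    V (suc a) b p q s _   = sym (δ-≥4 s j)
classify-δ≥4 j zero    V zero    b p q s V≡C = trans
  (cong (if_then live (V + b) (shapeOf p q) else dead) (≤ᵇ-false (≤-trans (subst (5 ≤_) (sym V≡C) (5≤C₂[4+j] j)) (m≤m+n V b))))
  (sym (δ-≥4 s j))

module Prepend (x : ℕ) (L : List ℕ) where

  a b : ℕ
  a = #triples R123 L
  b = #triples R132 L

  U : ℕ → ℕ
  U t = 𝟙 (t ≤ᵇ x) * #≥ x L + asc (unshift x t) L

  state-prepend-counts : ∀ n → state (suc n) (x ∷ map (shift x) L)
    ≡ classify (asc x L + a) (desc x L + b) (U (n ∸ 1)) (U (n ∸ 2))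
  state-prepend-counts n = trans (cong₂ (λ a' b' → classify a' b' (asc (n ∸ 1) L') (asc (n ∸ 2) L')) (#123-prepend x L) (#132-prepend x L))
                                 (cong₂ (classify (asc x L + a) (desc x L + b)) (asc-prepend x (n ∸ 1) L) (asc-prepend x (n ∸ 2) L))
    where L' = x ∷ map (shift x) L

  U-≤ : ∀ {t} → t ≤ x → U t ≡ #≥ x L + asc t L
  U-≤ {t} t≤x rewrite ≤ᵇ-true t≤x = cong₂ _+_ (*-identityˡ (#≥ x L)) (cong (λ u → asc u L) (unshift-≤ t≤x))

  U-> : ∀ {t} → x < t → U t ≡ asc (pred t) L
  U-> {t} x<t rewrite ≤ᵇ-false x<t = cong (λ u → asc u L) (unshift-> x<t)

  module _ {k : ℕ} (stats : PermutationStats (k + x) L) where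
    open PermutationStats stats

    #≥x≡gap : #≥ x L ≡ k
    #≥x≡gap = trans (#≥-≡ x) (m+n∸n≡m k x)

    asc+desc[x]≡C₂ : asc x L + desc x L ≡ C₂ k
    asc+desc[x]≡C₂ = trans (asc+desc x) (cong C₂ (m+n∸n≡m k x))

  no-pairs-above-x : asc x L + desc x L ≡ 0 → ∀ a' b' → classify (asc x L + a) (desc x L + b) a' b' ≡ classify a b a' b'
  no-pairs-above-x none a' b' = cong₂ (λ p q → classify (p + a) (q + b) a' b') (m+n≡0⇒m≡0 (asc x L) none) (m+n≡0⇒n≡0 (asc x L) none)

  state-after-gap : ∀ k → PermutationStats (k + x) L →
    classify (asc x L + a) (desc x L + b) (U ((k + x) ∸ 1)) (U ((k + x) ∸ 2)) ≡ δ (state (k + x) L) k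
  state-after-gap 0 stats = trans (no-pairs-above-x (asc+desc[x]≡C₂ stats) _ _)
    (trans (cong₂ (classify a b) u₂ u₃) (classify-δ₀ a b (asc (x ∸ 2) L) (asc (x ∸ 3) L)))
    where
    open PermutationStats stats
    u₂ : U (x ∸ 1) ≡ 0
    u₂ = trans (U-≤ (m∸n≤m x 1)) (cong₂ _+_ (#≥x≡gap stats) (m+n≡0⇒m≡0 _ (trans (asc+desc (x ∸ 1)) (C₂-pred-gap x))))
    u₃ : U (x ∸ 2) ≡ asc (x ∸ 2) L
    u₃ = trans (U-≤ (m∸n≤m x 2)) (cong (_+ asc (x ∸ 2) L) (#≥x≡gap stats))
  state-after-gap 1 stats = trans (no-pairs-above-x (asc+desc[x]≡C₂ stats) _ _)
    (trans (cong₂ (classify a b) (trans (U-≤ ≤-refl) (cong (_+ asc x L) (#≥x≡gap stats)))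
                                 (trans (U-≤ (m∸n≤m x 1)) (cong (_+ asc (x ∸ 1) L) (#≥x≡gap stats))))
           (classify-δ₁ a b _ _ (asc (x ∸ 1) L) (asc (x ∸ 2) L)))
  state-after-gap 2 stats = trans
    (cong₂ (classify (asc x L + a) (desc x L + b)) (U-> (n<1+n x)) (trans (U-≤ ≤-refl) (cong (_+ asc x L) (#≥x≡gap stats))))
    (classify-δ₂ a b (desc x L) (suc (asc x L)) (asc x L) (asc (x ∸ 1) L) (asc+desc[x]≡C₂ stats))
  state-after-gap 3 stats = trans
    (cong₂ (classify (asc x L + a) (desc x L + b)) (U-> (m<n⇒m<1+n (n<1+n x))) (U-> (n<1+n x)))
    (classify-δ₃ a b (desc x L) (asc (suc x) L) (asc x L) (asc+desc[x]≡C₂ stats) (asc-suc-≤ x L))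
  state-after-gap (suc (suc (suc (suc j)))) stats =
    classify-δ≥4 j (asc x L) (desc x L) a b _ _ (state (4 + j + x) L) (asc+desc[x]≡C₂ stats)

  state-prepend : ∀ k → PermutationStats (k + x) L → state (suc (k + x)) (x ∷ map (shift x) L) ≡ δ (state (k + x) L) k
  state-prepend k stats = trans (state-prepend-counts (k + x)) (state-after-gap k stats)

-- The census of states and its recurrence

_==ˢ_ : Shape → Shape → Bool
desc3 ==ˢ desc3 = true
desc2 ==ˢ desc2 = true
asc2  ==ˢ asc2  = true
_     ==ˢ _     = false

_==_ : State → State → Bool
dead     == dead       = true
live b q == live b' q' = (b ≡ᵇ b') ∧ (q ==ˢ q')
_        == _          = false

==ˢ-sound : ∀ q q' → T (q ==ˢ q') → q ≡ q'
==ˢ-sound desc3 desc3 _ = refl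
==ˢ-sound desc2 desc2 _ = refl
==ˢ-sound asc2  asc2  _ = refl

==-sound : ∀ u s → T (u == s) → u ≡ s
==-sound dead       dead         _  = refl
==-sound (live b q) (live b' q') eq with Equivalence.to T-∧ eq
... | b≡b' , q≡q' = cong₂ live (≡ᵇ⇒≡ b b' b≡b') (==ˢ-sound q q' q≡q')

shapes : List Shape
shapes = desc3 ∷ desc2 ∷ asc2 ∷ []

liveStates : List State
liveStates = concatMap (λ b → map (live b) shapes) (upTo 5)

states : List State
states = dead ∷ liveStates

∈-shapes : ∀ q → q ∈ shapes
∈-shapes desc3 = here refl
∈-shapes desc2 = there (here refl)
∈-shapes asc2  = there (there (here refl))

live-∈ : ∀ {b} q → b ≤ 4 → live b q ∈ liveStates
live-∈ {b} q b≤4 = ∈-concat⁺′ (∈-map⁺ (live b) (∈-shapes q)) (∈-map⁺ (λ b → map (live b) shapes) (∈-upTo⁺ (s≤s b≤4)))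

classify-∈ : ∀ a b u₂ u₃ → classify a b u₂ u₃ ∈ states
classify-∈ (suc a) b u₂ u₃ = here refl
classify-∈ zero    b u₂ u₃ with b ≤ᵇ 4 in b≤4
... | true  = there (live-∈ (shapeOf u₂ u₃) (≤ᵇ⇒≤ b 4 (subst T (sym b≤4) _)))
... | false = here refl

state-∈ : ∀ n L → state n L ∈ states
state-∈ n L = classify-∈ (#triples R123 L) (#triples R132 L) (asc (n ∸ 2) L) (asc (n ∸ 3) L)

∑-select : ∀ u (g : State → ℕ) xs → ∑[ s ∈ xs ] (𝟙 (u == s) * g s) ≡ ∑[ s ∈ xs ] 𝟙 (u == s) * g u
∑-select u g []       = refl
∑-select u g (s ∷ xs) with u == s in eq
... | true  = trans (cong₂ _+_ (cong (λ s → g s + 0) (sym (==-sound u s (subst T (sym eq) _)))) (∑-select u g xs))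
                    (sym (*-distribʳ-+ (g u) 1 (∑[ s ∈ xs ] 𝟙 (u == s))))
... | false = ∑-select u g xs

select : ∀ {xs u} (g : State → ℕ) → ListAll.All (λ u → ∑[ s ∈ xs ] 𝟙 (u == s) ≡ 1) xs → u ∈ xs →
         g u ≡ ∑[ s ∈ xs ] (𝟙 (u == s) * g s)
select {xs} {u} g once u∈xs =
  sym (trans (∑-select u g xs) (trans (cong (_* g u) (ListAll.lookup once u∈xs)) (+-identityʳ (g u))))

states-once : ListAll.All (λ u → ∑[ s ∈ states ] 𝟙 (u == s) ≡ 1) states
states-once = from-yes (ListAll.all? (λ u → ∑[ s ∈ states ] 𝟙 (u == s) ≟ℕ 1) states)

liveStates-once : ListAll.All (λ u → ∑[ s ∈ liveStates ] 𝟙 (u == s) ≡ 1) liveStates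
liveStates-once = from-yes (ListAll.all? (λ u → ∑[ s ∈ liveStates ] 𝟙 (u == s) ≟ℕ 1) liveStates)

∑-shapes-once : ∀ q₀ → ∑[ q ∈ shapes ] 𝟙 (q₀ ==ˢ q) ≡ 1
∑-shapes-once desc3 = refl
∑-shapes-once desc2 = refl
∑-shapes-once asc2  = refl

accepted : ∀ a b u₂ u₃ → 𝟙 ((a ≡ᵇ 0) ∧ (b ≡ᵇ 4)) ≡ ∑[ q ∈ shapes ] 𝟙 (classify a b u₂ u₃ == live 4 q)
accepted (suc a) b u₂ u₃ = refl
accepted zero    b u₂ u₃ with b ≤ᵇ 4 in b≤4
... | true = sym (begin
  ∑[ q ∈ shapes ] 𝟙 ((b ≡ᵇ 4) ∧ (q₀ ==ˢ q))       ≡⟨ ∑-cong (λ q → 𝟙-∧ (b ≡ᵇ 4) (q₀ ==ˢ q)) shapes ⟩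
  ∑[ q ∈ shapes ] (𝟙 (b ≡ᵇ 4) * 𝟙 (q₀ ==ˢ q))     ≡⟨ ∑-*ˡ (𝟙 (b ≡ᵇ 4)) (λ q → 𝟙 (q₀ ==ˢ q)) shapes ⟩
  𝟙 (b ≡ᵇ 4) * ∑[ q ∈ shapes ] 𝟙 (q₀ ==ˢ q)       ≡⟨ cong (𝟙 (b ≡ᵇ 4) *_) (∑-shapes-once q₀) ⟩
  𝟙 (b ≡ᵇ 4) * 1                                  ≡⟨ *-identityʳ (𝟙 (b ≡ᵇ 4)) ⟩
  𝟙 (b ≡ᵇ 4)                                      ∎)
  where
  open ≡-Reasoning
  q₀ = shapeOf u₂ u₃
... | false with b ≡ᵇ 4 in b≡4
...   | false = refl
...   | true  = ⊥-elim (<-irrefl (sym (≡ᵇ⇒≡ b 4 (subst T (sym b≡4) _))) (≤ᵇ-false⁻ b≤4))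

-- Opaque, so that the typechecker never unfolds this sum over all n^n words.
opaque
  census : ℕ → State → ℕ
  census n s = ∑[ σ ∈ allVecs n n ] (𝟙 (does (unique? σ)) * 𝟙 (state n (values σ) == s))

flow : (State → ℕ) → ℕ → State → ℕ
flow M k s = ∑[ s' ∈ states ] (𝟙 (δ s' k == s) * M s')

step : (State → ℕ) → ℕ → State → ℕ
step M n s = ∑[ k ∈ downFrom (suc n) ] flow M k s

state-prepend-perm : ∀ {n} (x : Fin (suc n)) (σ : Vec (Fin n) n) → Unique σ →
  state (suc n) (toℕ x ∷ map (shift (toℕ x)) (values σ)) ≡ δ (state n (values σ)) (n ∸ toℕ x)
state-prepend-perm {n} x σ u =
  subst (λ m → state (suc m) (toℕ x ∷ map (shift (toℕ x)) L) ≡ δ (state m L) (n ∸ toℕ x)) gap+x≡n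
        (Prepend.state-prepend (toℕ x) L (n ∸ toℕ x) (subst (λ m → PermutationStats m L) (sym gap+x≡n) (permutationStats σ u)))
  where
  L = values σ
  gap+x≡n : n ∸ toℕ x + toℕ x ≡ n
  gap+x≡n = m∸n+n≡m (toℕ≤pred[n] x)

census-summand-prepend : ∀ {n} (x : Fin (suc n)) (σ : Vec (Fin n) n) s →
  𝟙 (does (unique? (Vec.map (punchIn x) σ))) * 𝟙 (state (suc n) (values (x ∷ Vec.map (punchIn x) σ)) == s)
    ≡ 𝟙 (does (unique? σ)) * 𝟙 (δ (state n (values σ)) (n ∸ toℕ x) == s)
census-summand-prepend x σ s rewrite does-unique-punchIn x σ | values-punchIn x σ with unique? σ
... | yes u = cong (λ st → 1 * 𝟙 (st == s)) (state-prepend-perm x σ u)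
... | no _  = refl

∑-through-states : {A : Set} (xs : List A) (w : A → ℕ) (f : A → State) (g : State → ℕ) → (∀ a → f a ∈ states) →
  ∑[ a ∈ xs ] (w a * g (f a)) ≡ ∑[ s ∈ states ] (g s * ∑[ a ∈ xs ] (w a * 𝟙 (f a == s)))
∑-through-states xs w f g f∈states = begin
  ∑[ a ∈ xs ] (w a * g (f a))                                ≡⟨ ∑-cong (λ a → cong (w a *_) (select g states-once (f∈states a))) xs ⟩
  ∑[ a ∈ xs ] (w a * ∑[ s ∈ states ] (𝟙 (f a == s) * g s))   ≡⟨ ∑-cong (λ a → sym (∑-*ˡ (w a) (λ s → 𝟙 (f a == s) * g s) states)) xs ⟩
  ∑[ a ∈ xs ] ∑[ s ∈ states ] (w a * (𝟙 (f a == s) * g s))   ≡⟨ ∑-comm (λ a s → w a * (𝟙 (f a == s) * g s)) xs states ⟩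
  ∑[ s ∈ states ] ∑[ a ∈ xs ] (w a * (𝟙 (f a == s) * g s))   ≡⟨ ∑-cong (λ s → ∑-cong (λ a → sym (*-assoc (w a) (𝟙 (f a == s)) (g s))) xs) states ⟩
  ∑[ s ∈ states ] ∑[ a ∈ xs ] (w a * 𝟙 (f a == s) * g s)     ≡⟨ ∑-cong (λ s → trans (∑-*ʳ (g s) (λ a → w a * 𝟙 (f a == s)) xs) (*-comm (∑[ a ∈ xs ] (w a * 𝟙 (f a == s))) (g s))) states ⟩
  ∑[ s ∈ states ] (g s * ∑[ a ∈ xs ] (w a * 𝟙 (f a == s)))   ∎
  where open ≡-Reasoning

opaque
  unfolding census

  census-zero : ∀ s → census 0 s ≡ 𝟙 (live 0 desc3 == s)
  census-zero s = trans (+-identityʳ (1 * 𝟙 (live 0 desc3 == s))) (*-identityˡ (𝟙 (live 0 desc3 == s)))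

  census-suc : ∀ n s → census (suc n) s ≡ step (census n) n s
  census-suc n s = begin
    census (suc n) s
      ≡⟨ ∑-allVecs-suc (suc n) n _ ⟩
    ∑[ x ∈ allFin (suc n) ] ∑[ w ∈ allVecs (suc n) n ] summand (x ∷ w)
      ≡⟨ ∑-cong (λ x → ∑-cong (λ w → split x w) (allVecs (suc n) n)) (allFin (suc n)) ⟩
    ∑[ x ∈ allFin (suc n) ] ∑[ w ∈ allVecs (suc n) n ] (𝟙 (does (avoids? x w)) * after x w)
      ≡⟨ ∑-cong (λ x → ∑-avoiding x n (after x)) (allFin (suc n)) ⟩
    ∑[ x ∈ allFin (suc n) ] ∑[ σ ∈ allVecs n n ] after x (Vec.map (punchIn x) σ)
      ≡⟨ ∑-cong (λ x → ∑-cong (λ σ → census-summand-prepend x σ s) (allVecs n n)) (allFin (suc n)) ⟩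
    ∑[ x ∈ allFin (suc n) ] ∑[ σ ∈ allVecs n n ] (𝟙 (does (unique? σ)) * 𝟙 (δ (state n (values σ)) (n ∸ toℕ x) == s))
      ≡⟨ ∑-cong (λ x → ∑-through-states (allVecs n n) (𝟙 ∘ does ∘ unique?) (state n ∘ values)
                                         (λ s' → 𝟙 (δ s' (n ∸ toℕ x) == s)) (state-∈ n ∘ values)) (allFin (suc n)) ⟩
    ∑[ x ∈ allFin (suc n) ] flow (census n) (n ∸ toℕ x) s
      ≡⟨ ∑-allFin-downFrom n (λ k → flow (census n) k s) ⟩
    step (census n) n s ∎
    where
    open ≡-Reasoning
    summand : Word (suc n) → ℕ
    summand w = 𝟙 (does (unique? w)) * 𝟙 (state (suc n) (values w) == s)
    after : Fin (suc n) → Vec (Fin (suc n)) n → ℕ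
    after x w = 𝟙 (does (unique? w)) * 𝟙 (state (suc n) (values (x ∷ w)) == s)
    split : ∀ x w → summand (x ∷ w) ≡ 𝟙 (does (avoids? x w)) * after x w
    split x w = trans (cong (_* 𝟙 (state (suc n) (values (x ∷ w)) == s)) (𝟙-∧ (does (avoids? x w)) _))
                      (*-assoc (𝟙 (does (avoids? x w))) _ _)

  count≡census : ∀ n → count 4 n ≡ ∑[ q ∈ shapes ] census n (live 4 q)
  count≡census n = begin
    count 4 n
      ≡⟨ length-filter (good? 4) (perms n) ⟩
    ∑[ w ∈ perms n ] 𝟙 (does (good? 4 w))
      ≡⟨ ∑-filter isPerm? (𝟙 ∘ does ∘ good? 4) (allVecs n n) ⟩
    ∑[ w ∈ allVecs n n ] (𝟙 (does (isPerm? w)) * 𝟙 (does (good? 4 w)))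
      ≡⟨ ∑-cong (λ w → cong₂ _*_ (cong 𝟙 (does-isPerm w)) (good≡accepted w)) (allVecs n n) ⟩
    ∑[ w ∈ allVecs n n ] (𝟙 (does (unique? w)) * ∑[ q ∈ shapes ] 𝟙 (state n (values w) == live 4 q))
      ≡⟨ ∑-cong (λ w → sym (∑-*ˡ (𝟙 (does (unique? w))) (λ q → 𝟙 (state n (values w) == live 4 q)) shapes)) (allVecs n n) ⟩
    ∑[ w ∈ allVecs n n ] ∑[ q ∈ shapes ] (𝟙 (does (unique? w)) * 𝟙 (state n (values w) == live 4 q))
      ≡⟨ ∑-comm (λ w q → 𝟙 (does (unique? w)) * 𝟙 (state n (values w) == live 4 q)) (allVecs n n) shapes ⟩
    ∑[ q ∈ shapes ] census n (live 4 q) ∎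
    where
    open ≡-Reasoning
    good≡accepted : ∀ (w : Word n) → 𝟙 (does (good? 4 w)) ≡ ∑[ q ∈ shapes ] 𝟙 (state n (values w) == live 4 q)
    good≡accepted w = trans (cong₂ (λ a b → 𝟙 ((a ≡ᵇ 0) ∧ (b ≡ᵇ 4))) (#123≡#triples w) (#132≡#triples w))
                            (accepted (#triples R123 (values w)) (#triples R132 (values w)) (asc (n ∸ 2) (values w)) (asc (n ∸ 3) (values w)))

_≋_ : (State → ℕ) → (State → ℕ) → Set
M ≋ M' = ∀ {s} → s ∈ liveStates → M s ≡ M' s

dead≠live : ListAll.All (λ s → (dead == s) ≡ false) liveStates
dead≠live = from-yes (ListAll.all? (λ s → (dead == s) ≟ᵇ false) liveStates)

flow-cong : ∀ {M M'} → M ≋ M' → ∀ k → flow M k ≋ flow M' k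
flow-cong {M} {M'} M≋M' k {s} s∈live =
  cong₂ _+_ dead-term (∑-cong-∈ liveStates (λ {s'} s'∈live → cong (𝟙 (δ s' k == s) *_) (M≋M' s'∈live)))
  where
  dead-term : 𝟙 (dead == s) * M dead ≡ 𝟙 (dead == s) * M' dead
  dead-term rewrite ListAll.lookup dead≠live s∈live = refl

step-cong : ∀ {M M'} → M ≋ M' → ∀ n → step M n ≋ step M' n
step-cong M≋M' n s∈live = ∑-cong (λ k → flow-cong M≋M' k s∈live) (downFrom (suc n))

lookupState : List State → List ℕ → State → ℕ
lookupState (s' ∷ ss) (x ∷ xs) s = 𝟙 (s == s') * x + lookupState ss xs s
lookupState _         _        _ = 0

lookupState-tabulate : ∀ (f : State → ℕ) → lookupState liveStates (map f liveStates) ≋ f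
lookupState-tabulate f {s} s∈live = trans (lookup-map liveStates) (sym (select f liveStates-once s∈live))
  where
  lookup-map : ∀ ss → lookupState ss (map f ss) s ≡ ∑[ s' ∈ ss ] (𝟙 (s == s') * f s')
  lookup-map []       = refl
  lookup-map (s' ∷ ss) = cong (𝟙 (s == s') * f s' +_) (lookup-map ss)

-- The previous table is passed as an argument so that evaluation shares it.
nextTable : ℕ → List ℕ → List ℕ
nextTable n t = map (step (lookupState liveStates t) n) liveStates

table : ℕ → List ℕ
table zero    = map (λ s → 𝟙 (live 0 desc3 == s)) liveStates
table (suc n) = nextTable n (table n)

census≋table : ∀ n → census n ≋ lookupState liveStates (table n)
census≋table zero {s} s∈live = trans (census-zero s) (sym (lookupState-tabulate (λ s → 𝟙 (live 0 desc3 == s)) s∈live))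
census≋table (suc n) {s} s∈live = begin
  census (suc n) s                                             ≡⟨ census-suc n s ⟩
  step (census n) n s                                          ≡⟨ step-cong (census≋table n) n s∈live ⟩
  step (lookupState liveStates (table n)) n s                  ≡⟨ lookupState-tabulate (step (lookupState liveStates (table n)) n) s∈live ⟨
  lookupState liveStates (table (suc n)) s                     ∎
  where open ≡-Reasoning

-- Closed form

basis : ℕ → ℕ → ℕ
basis j m = (m C j) * 2 ^ (m ∸ j)

evalFrom : ℕ → List ℕ → ℕ → ℕ
evalFrom j []       m = 0
evalFrom j (c ∷ cs) m = c * basis j m + evalFrom (suc j) cs m

eval : List ℕ → ℕ → ℕ
eval = evalFrom 0

infixl 6 _⊕_
_⊕_ : List ℕ → List ℕ → List ℕ
[]       ⊕ ds       = ds
(c ∷ cs) ⊕ []       = c ∷ cs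
(c ∷ cs) ⊕ (d ∷ ds) = c + d ∷ cs ⊕ ds

scale : ℕ → List ℕ → List ℕ
scale k = map (k *_)

advance : List ℕ → List ℕ
advance cs = scale 2 cs ⊕ drop 1 cs

evalFrom-⊕ : ∀ j cs ds m → evalFrom j (cs ⊕ ds) m ≡ evalFrom j cs m + evalFrom j ds m
evalFrom-⊕ j []       ds       m = refl
evalFrom-⊕ j (c ∷ cs) []       m = sym (+-identityʳ _)
evalFrom-⊕ j (c ∷ cs) (d ∷ ds) m rewrite evalFrom-⊕ (suc j) cs ds m | *-distribʳ-+ (basis j m) c d =
  interchange (c * basis j m) (d * basis j m) (evalFrom (suc j) cs m) (evalFrom (suc j) ds m)

evalFrom-scale : ∀ j k cs m → evalFrom j (scale k cs) m ≡ k * evalFrom j cs m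
evalFrom-scale j k []       m = sym (*-zeroʳ k)
evalFrom-scale j k (c ∷ cs) m rewrite evalFrom-scale (suc j) k cs m | *-assoc k c (basis j m) =
  sym (*-distribˡ-+ k (c * basis j m) (evalFrom (suc j) cs m))

basis-suc : ∀ j m → basis (suc j) (suc m) ≡ 2 * basis (suc j) m + basis j m
basis-suc j m with j <? m
... | yes j<m = begin
  (suc m C suc j) * 2 ^ (m ∸ j)                         ≡⟨ cong (_* 2 ^ (m ∸ j)) (nCk+nC[k+1]≡[n+1]C[k+1] m j) ⟨
  (m C j + (m C suc j)) * 2 ^ (m ∸ j)                   ≡⟨ *-distribʳ-+ (2 ^ (m ∸ j)) (m C j) (m C suc j) ⟩
  basis j m + (m C suc j) * 2 ^ (m ∸ j)                 ≡⟨ cong (λ e → basis j m + (m C suc j) * 2 ^ e) (+-∸-assoc 1 j<m) ⟩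
  basis j m + (m C suc j) * (2 * 2 ^ (m ∸ suc j))       ≡⟨ cong (basis j m +_) (x∙yz≈y∙xz (m C suc j) 2 (2 ^ (m ∸ suc j))) ⟩
  basis j m + 2 * basis (suc j) m                     ≡⟨ +-comm (basis j m) _ ⟩
  2 * basis (suc j) m + basis j m                     ∎
  where open ≡-Reasoning
... | no j≮m = begin
  (suc m C suc j) * 2 ^ (m ∸ j)                         ≡⟨ cong (_* 2 ^ (m ∸ j)) (nCk+nC[k+1]≡[n+1]C[k+1] m j) ⟨
  (m C j + (m C suc j)) * 2 ^ (m ∸ j)                   ≡⟨ cong (λ c → (m C j + c) * 2 ^ (m ∸ j)) m<suc-j ⟩
  (m C j + 0) * 2 ^ (m ∸ j)                           ≡⟨ cong (_* 2 ^ (m ∸ j)) (+-identityʳ (m C j)) ⟩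
  basis j m                                           ≡⟨ cong (λ c → 2 * (c * 2 ^ (m ∸ suc j)) + basis j m) m<suc-j ⟨
  2 * basis (suc j) m + basis j m                     ∎
  where
  open ≡-Reasoning
  m<suc-j : m C suc j ≡ 0
  m<suc-j = k>n⇒nCk≡0 (s≤s (≮⇒≥ j≮m))

evalFrom-suc : ∀ j cs m → evalFrom (suc j) cs (suc m) ≡ 2 * evalFrom (suc j) cs m + evalFrom j cs m
evalFrom-suc j []       m = refl
evalFrom-suc j (c ∷ cs) m rewrite basis-suc j m | evalFrom-suc (suc j) cs m =
  solve 5 (λ c e₁ e₀ v₁ v₀ → c :* (con 2 :* e₁ :+ e₀) :+ (con 2 :* v₁ :+ v₀) := con 2 :* (c :* e₁ :+ v₁) :+ (c :* e₀ :+ v₀))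
        refl c (basis (suc j) m) (basis j m) (evalFrom (suc (suc j)) cs m) (evalFrom (suc j) cs m)
  where open +-*-Solver

eval-advance : ∀ cs m → eval cs (suc m) ≡ eval (advance cs) m
eval-advance []       m = refl
eval-advance (c ∷ cs) m = begin
  c * basis 0 (suc m) + evalFrom 1 cs (suc m)                ≡⟨ cong₂ _+_ (cong (c *_) basis-0-suc) (evalFrom-suc 0 cs m) ⟩
  c * (2 * basis 0 m) + (2 * evalFrom 1 cs m + eval cs m)     ≡⟨ solve 4 (λ c e v w → c :* (con 2 :* e) :+ (con 2 :* v :+ w) := con 2 :* (c :* e :+ v) :+ w)
                                                                       refl c (basis 0 m) (evalFrom 1 cs m) (eval cs m) ⟩
  2 * eval (c ∷ cs) m + eval cs m                             ≡⟨ cong₂ _+_ (evalFrom-scale 0 2 (c ∷ cs) m) refl ⟨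
  eval (scale 2 (c ∷ cs)) m + eval cs m                       ≡⟨ evalFrom-⊕ 0 (scale 2 (c ∷ cs)) cs m ⟨
  eval (advance (c ∷ cs)) m                                   ∎
  where
  open ≡-Reasoning
  open +-*-Solver
  basis-0-suc : basis 0 (suc m) ≡ 2 * basis 0 m
  basis-0-suc = trans (+-identityʳ (2 * 2 ^ m)) (cong (2 *_) (sym (+-identityʳ (2 ^ m))))

⨁ : {A : Set} → List A → (A → List ℕ) → List ℕ
⨁ []       c = []
⨁ (x ∷ xs) c = c x ⊕ ⨁ xs c

syntax ⨁ xs (λ x → e) = ⨁[ x ∈ xs ] e

eval-⨁ : {A : Set} (xs : List A) (c : A → List ℕ) (m : ℕ) → ∑[ x ∈ xs ] eval (c x) m ≡ eval (⨁[ x ∈ xs ] c x) m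
eval-⨁ []       c m = refl
eval-⨁ (x ∷ xs) c m = trans (cong (eval (c x) m +_) (eval-⨁ xs c m)) (sym (evalFrom-⊕ 0 (c x) (⨁ xs c) m))

-- census (7 + m) s = eval (closedCoeffs s) m; the coefficients come from solving the recurrence.
closedCoeffs : State → List ℕ
closedCoeffs (live 0 desc3) = 16 ∷  0 ∷  0 ∷ 0 ∷ 0 ∷ []
closedCoeffs (live 0 desc2) = 16 ∷  0 ∷  0 ∷ 0 ∷ 0 ∷ []
closedCoeffs (live 0 asc2)  = 32 ∷  0 ∷  0 ∷ 0 ∷ 0 ∷ []
closedCoeffs (live 1 desc3) = 20 ∷  8 ∷  0 ∷ 0 ∷ 0 ∷ []
closedCoeffs (live 1 desc2) = 28 ∷  8 ∷  0 ∷ 0 ∷ 0 ∷ []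
closedCoeffs (live 1 asc2)  = 32 ∷ 16 ∷  0 ∷ 0 ∷ 0 ∷ []
closedCoeffs (live 2 desc3) = 13 ∷ 12 ∷  4 ∷ 0 ∷ 0 ∷ []
closedCoeffs (live 2 desc2) = 25 ∷ 16 ∷  4 ∷ 0 ∷ 0 ∷ []
closedCoeffs (live 2 asc2)  = 18 ∷ 20 ∷  8 ∷ 0 ∷ 0 ∷ []
closedCoeffs (live 3 desc3) = 21 ∷ 13 ∷  7 ∷ 2 ∷ 0 ∷ []
closedCoeffs (live 3 desc2) = 18 ∷ 20 ∷  9 ∷ 2 ∷ 0 ∷ []
closedCoeffs (live 3 asc2)  = 18 ∷ 21 ∷ 12 ∷ 4 ∷ 0 ∷ []
closedCoeffs (live 4 desc3) = 17 ∷ 18 ∷ 10 ∷ 4 ∷ 1 ∷ []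
closedCoeffs (live 4 desc2) = 15 ∷ 20 ∷ 14 ∷ 5 ∷ 1 ∷ []
closedCoeffs (live 4 asc2)  = 11 ∷ 21 ∷ 17 ∷ 7 ∷ 2 ∷ []
closedCoeffs _              = []

closed : ℕ → State → ℕ
closed m s = eval (closedCoeffs s) m

stepCoeffs : State → List ℕ
stepCoeffs s = ⨁[ k ∈ downFrom 4 ] ⨁[ s' ∈ states ] scale (𝟙 (δ s' k == s)) (closedCoeffs s')

stepCoeffs≡advance : ListAll.All (λ s → stepCoeffs s ≡ advance (closedCoeffs s)) liveStates
stepCoeffs≡advance = from-yes (ListAll.all? (λ s → ≡-dec _≟ℕ_ (stepCoeffs s) (advance (closedCoeffs s))) liveStates)

flow-≥4 : ∀ M j {s} → s ∈ liveStates → flow M (4 + j) s ≡ 0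
flow-≥4 M j {s} s∈live = trans (∑-cong (λ s' → cong (λ u → 𝟙 (u == s) * M s') (δ-≥4 s' j)) states)
  (subst (λ b → ∑[ s' ∈ states ] (𝟙 b * M s') ≡ 0) (sym (ListAll.lookup dead≠live s∈live)) (∑-zero states))

step-large : ∀ M n {s} → s ∈ liveStates → step M (3 + n) s ≡ ∑[ k ∈ downFrom 4 ] flow M k s
step-large M zero    s∈live = refl
step-large M (suc n) {s} s∈live = trans (cong (_+ step M (3 + n) s) (flow-≥4 M n s∈live)) (step-large M n s∈live)

step-closed : ∀ m → step (closed m) (7 + m) ≋ closed (suc m)
step-closed m {s} s∈live = begin
  step (closed m) (3 + (4 + m)) s
    ≡⟨ step-large (closed m) (4 + m) s∈live ⟩
  ∑[ k ∈ downFrom 4 ] ∑[ s' ∈ states ] (𝟙 (δ s' k == s) * eval (closedCoeffs s') m)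
    ≡⟨ ∑-cong (λ k → ∑-cong (λ s' → sym (evalFrom-scale 0 (𝟙 (δ s' k == s)) (closedCoeffs s') m)) states) (downFrom 4) ⟩
  ∑[ k ∈ downFrom 4 ] ∑[ s' ∈ states ] eval (scale (𝟙 (δ s' k == s)) (closedCoeffs s')) m
    ≡⟨ ∑-cong (λ k → eval-⨁ states (λ s' → scale (𝟙 (δ s' k == s)) (closedCoeffs s')) m) (downFrom 4) ⟩
  ∑[ k ∈ downFrom 4 ] eval (⨁[ s' ∈ states ] scale (𝟙 (δ s' k == s)) (closedCoeffs s')) m
    ≡⟨ eval-⨁ (downFrom 4) (λ k → ⨁[ s' ∈ states ] scale (𝟙 (δ s' k == s)) (closedCoeffs s')) m ⟩
  eval (stepCoeffs s) m
    ≡⟨ cong (λ cs → eval cs m) (ListAll.lookup stepCoeffs≡advance s∈live) ⟩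
  eval (advance (closedCoeffs s)) m
    ≡⟨ eval-advance (closedCoeffs s) m ⟨
  closed (suc m) s ∎
  where open ≡-Reasoning

census≋closed : ∀ m → census (7 + m) ≋ closed m
census≋closed zero {s} s∈live = begin
  census 7 s                                            ≡⟨ census≋table 7 s∈live ⟩
  lookupState liveStates (table 7) s                    ≡⟨ cong (λ t → lookupState liveStates t s) table₇ ⟩
  lookupState liveStates (map (closed 0) liveStates) s  ≡⟨ lookupState-tabulate (closed 0) s∈live ⟩
  closed 0 s                                            ∎
  where
  open ≡-Reasoning
  table₇ : table 7 ≡ map (closed 0) liveStates
  table₇ = from-yes (≡-dec _≟ℕ_ (table 7) (map (closed 0) liveStates))
census≋closed (suc m) {s} s∈live = begin
  census (8 + m) s              ≡⟨ census-suc (7 + m) s ⟩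
  step (census (7 + m)) (7 + m) s ≡⟨ step-cong (census≋closed m) (7 + m) s∈live ⟩
  step (closed m) (7 + m) s     ≡⟨ step-closed m s∈live ⟩
  closed (suc m) s              ∎
  where open ≡-Reasoning

unit : ℕ → List ℕ
unit zero    = 1 ∷ []
unit (suc j) = 0 ∷ unit j

evalFrom-unit : ∀ i j m → evalFrom i (unit j) m ≡ basis (j + i) m
evalFrom-unit i zero    m = trans (+-identityʳ (1 * basis i m)) (*-identityˡ (basis i m))
evalFrom-unit i (suc j) m = trans (evalFrom-unit (suc i) j m) (cong (λ t → basis t m) (+-suc j i))

eval-iterate-advance : ∀ k cs m → eval cs (k + m) ≡ eval (iterate advance cs k) m
eval-iterate-advance zero    cs m = refl
eval-iterate-advance (suc k) cs m = trans (eval-advance cs (k + m)) (eval-iterate-advance k (advance cs) m)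

basis-shifted : ∀ k j m → basis j (k + m) ≡ eval (iterate advance (unit j) k) m
basis-shifted k j m = trans (cong (λ t → basis t (k + m)) (sym (+-identityʳ j)))
                            (trans (sym (evalFrom-unit 0 j (k + m))) (eval-iterate-advance k (unit j) m))

formulaCoeffs : List ℕ
formulaCoeffs = scale 2 (iterate advance (unit 1) 3) ⊕ scale 3 (iterate advance (unit 2) 3)
              ⊕ iterate advance (unit 3) 3 ⊕ iterate advance (unit 3) 2 ⊕ iterate advance (unit 4) 2

formulaCoeffs≡accepted : formulaCoeffs ≡ ⨁[ q ∈ shapes ] closedCoeffs (live 4 q)
formulaCoeffs≡accepted = from-yes (≡-dec _≟ℕ_ formulaCoeffs (⨁[ q ∈ shapes ] closedCoeffs (live 4 q)))

eval-combination : ∀ a b c d e m → 2 * eval a m + 3 * eval b m + eval c m + eval d m + eval e m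
                                  ≡ eval (scale 2 a ⊕ scale 3 b ⊕ c ⊕ d ⊕ e) m
eval-combination a b c d e m
  rewrite evalFrom-⊕ 0 (scale 2 a ⊕ scale 3 b ⊕ c ⊕ d) e m | evalFrom-⊕ 0 (scale 2 a ⊕ scale 3 b ⊕ c) d m
        | evalFrom-⊕ 0 (scale 2 a ⊕ scale 3 b) c m | evalFrom-⊕ 0 (scale 2 a) (scale 3 b) m
        | evalFrom-scale 0 2 a m | evalFrom-scale 0 3 b m = refl

-- formula (7 + m) = 2·basis 1 (3 + m) + 3·basis 2 (3 + m) + basis 3 (3 + m) + basis 3 (2 + m) + basis 4 (2 + m).
formula-eval : ∀ m → formula (7 + m) ≡ eval formulaCoeffs m
formula-eval m =
  trans (cong₂ (λ x y → x + y + basis 3 (3 + m) + basis 3 (2 + m) + basis 4 (2 + m))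
               (*-assoc 2 ((3 + m) C 1) (2 ^ (2 + m))) (*-assoc 3 ((3 + m) C 2) (2 ^ (1 + m))))
  (trans (cong₂ _+_ (cong₂ _+_ (cong₂ _+_ (cong₂ _+_ (cong (2 *_) (basis-shifted 3 1 m)) (cong (3 *_) (basis-shifted 3 2 m)))
                                          (basis-shifted 3 3 m)) (basis-shifted 2 3 m)) (basis-shifted 2 4 m))
         (eval-combination (iterate advance (unit 1) 3) (iterate advance (unit 2) 3) (iterate advance (unit 3) 3)
                           (iterate advance (unit 3) 2) (iterate advance (unit 4) 2) m))

accepted-table₅ : ∑[ q ∈ shapes ] lookupState liveStates (table 5) (live 4 q) ≡ formula 5
accepted-table₅ = from-yes (∑[ q ∈ shapes ] lookupState liveStates (table 5) (live 4 q) ≟ℕ formula 5)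

accepted-table₆ : ∑[ q ∈ shapes ] lookupState liveStates (table 6) (live 4 q) ≡ formula 6
accepted-table₆ = from-yes (∑[ q ∈ shapes ] lookupState liveStates (table 6) (live 4 q) ≟ℕ formula 6)

∑-accepted-≋ : ∀ {M M'} → M ≋ M' → ∑[ q ∈ shapes ] M (live 4 q) ≡ ∑[ q ∈ shapes ] M' (live 4 q)
∑-accepted-≋ M≋M' = ∑-cong (λ q → M≋M' (live-∈ q ≤-refl)) shapes

accepted-census : ∀ j → ∑[ q ∈ shapes ] census (5 + j) (live 4 q) ≡ formula (5 + j)
accepted-census 0 = trans (∑-accepted-≋ {census 5} {lookupState liveStates (table 5)} (census≋table 5)) accepted-table₅
accepted-census 1 = trans (∑-accepted-≋ {census 6} {lookupState liveStates (table 6)} (census≋table 6)) accepted-table₆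
accepted-census (suc (suc m)) = begin
  ∑[ q ∈ shapes ] census (7 + m) (live 4 q)         ≡⟨ ∑-accepted-≋ {census (7 + m)} {closed m} (census≋closed m) ⟩
  ∑[ q ∈ shapes ] closed m (live 4 q)               ≡⟨ eval-⨁ shapes (closedCoeffs ∘ live 4) m ⟩
  eval (⨁[ q ∈ shapes ] closedCoeffs (live 4 q)) m  ≡⟨ cong (λ cs → eval cs m) formulaCoeffs≡accepted ⟨
  eval formulaCoeffs m                              ≡⟨ formula-eval m ⟨
  formula (7 + m)                                   ∎
  where open ≡-Reasoning

mainTheorem5 : (n : ℕ) → 5 ≤ n → count 4 n ≡ formula n
mainTheorem5 n 5≤n with j , refl ← m≤n⇒∃[o]m+o≡n 5≤n = trans (count≡census (5 + j)) (accepted-census j)
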